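{- Let $L$ be a finite lattice such that the poset $\mathcal J(L)$ is itself a lattice, and let $G$ be a finite undirected graph with $\mathrm{End}(G)\cong(L,\wedge)$. If $y,z\in\mathcal J(L)$ are different, then the private parts $P(y)$ and $P(z)$ are disjoint.
   Context: $\mathrm{End}(G)$ is the monoid of maps $V(G)\to V(G)$ sending edges to edges. When $\mathrm{End}(G)\cong(L,\wedge)$, each $\ell\in L$ corresponds (via the fixed isomorphism) to an endomorphism which is a retraction (identity on its image); $R(\ell)$ denotes its image (the retract), and $\ell\leq\ell'$ iff $R(\ell)\subseteq R(\ell')$. $\mathcal J(L)$ is the subposet of join-irreducible elements ($\ell$ with: $\bigvee I=\ell\Rightarrow\ell\in I$ for all $I\subseteq L$). For $y\in\mathcal J(L)$ with $C\subseteq\mathcal J(L)$ the set of elements covered by $y$ in $\mathcal J(L)$, the set $R(y)\setminus R(\bigvee C)$ is non-empty and connected, and the private part $P(y)$ is defined as the connected component of the subgraph of $G$ induced by $R(y)\setminus\bigcup_{x\in C}R(x)$ that contains $R(y)\setminus R(\bigvee C)$. -}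

module Defs where

open import Level using (Level)
open import Data.Nat using (ℕ)
open import Data.Fin using (Fin)
open import Data.Bool using (Bool; true; false)
open import Data.Product using (Σ; ∃; _×_; _,_)
open import Relation.Nullary using (¬_)
open import Relation.Binary.PropositionalEquality using (_≡_)
open import Relation.Binary.Lattice.Structures using (IsLattice)

-- Finite lattices: carrier Fin m (every finite lattice is isomorphic to
-- one of this form), equality is propositional equality.

record FinLattice : Set₁ where
  field
    m         : ℕ
    _≤_       : Fin m → Fin m → Set
    _∨_       : Fin m → Fin m → Fin m
    _∧_       : Fin m → Fin m → Fin m
    isLattice : IsLattice _≡_ _≤_ _∨_ _∧_

  Carrier : Set
  Carrier = Fin m

  _<_ : Carrier → Carrier → Set
  x < y = (x ≤ y) × ¬ (x ≡ y)

  IsSup : ∀ {a : Level} → (Carrier → Set a) → Carrier → Set a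
  IsSup I ℓ = (∀ x → I x → x ≤ ℓ) × (∀ u → (∀ x → I x → x ≤ u) → ℓ ≤ u)

  JoinIrr : Carrier → Set₁
  JoinIrr ℓ = (I : Carrier → Set) → IsSup I ℓ → I ℓ

  JIsLattice : Set₁
  JIsLattice =
    ∀ x y → JoinIrr x → JoinIrr y →
      (Σ Carrier λ s → JoinIrr s × x ≤ s × y ≤ s ×
         (∀ u → JoinIrr u → x ≤ u → y ≤ u → s ≤ u))
    × (Σ Carrier λ i → JoinIrr i × i ≤ x × i ≤ y ×
         (∀ u → JoinIrr u → u ≤ x → u ≤ y → u ≤ i))

  CoveredInJ : Carrier → Carrier → Set₁
  CoveredInJ y x = JoinIrr x × x < y ×
    (∀ w → JoinIrr w → x < w → w < y → Data.Empty.⊥)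
    where import Data.Empty

record Graph : Set where
  field
    n       : ℕ
    adj     : Fin n → Fin n → Bool
    sym     : ∀ u v → adj u v ≡ adj v u
    irrefl  : ∀ v → adj v v ≡ false

  Vertex : Set
  Vertex = Fin n

  Edge : Vertex → Vertex → Set
  Edge u v = adj u v ≡ true

  IsEnd : (Vertex → Vertex) → Set
  IsEnd f = ∀ u v → Edge u v → Edge (f u) (f v)

  End : Set
  End = Σ (Vertex → Vertex) IsEnd

  _≈E_ : End → End → Set
  (f , _) ≈E (g , _) = ∀ v → f v ≡ g v

  _∘E_ : End → End → End
  (f , pf) ∘E (g , pg) = (λ v → f (g v)) , (λ u v e → pf (g u) (g v) (pg u v e))

  idE : End
  idE = (λ v → v) , (λ u v e → e)

  data Reach {a : Level} (S : Vertex → Set a) : Vertex → Vertex → Set a where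
    here : ∀ {w} → S w → Reach S w w
    step : ∀ {w u v} → Reach S w u → Edge u v → S v → Reach S w v

-- A monoid isomorphism End(G) ≅ (L, ∧)  (the identity of (L,∧) is the top).

record EndIso (L : FinLattice) (G : Graph) : Set₁ where
  open FinLattice L
  open Graph G
  field
    φ        : Carrier → End
    φ-hom    : ∀ a b → φ (a ∧ b) ≈E (φ a ∘E φ b)
    φ-unit   : Σ Carrier (λ t → (∀ x → x ≤ t) × φ t ≈E idE)
    φ-inj    : ∀ a b → φ a ≈E φ b → a ≡ b
    φ-surj   : ∀ (f : End) → Σ Carrier λ a → φ a ≈E f

  R : Carrier → Vertex → Set
  R ℓ v = ∃ λ u → Data.Product.proj₁ (φ ℓ) u ≡ v
    where import Data.Product

  S : Carrier → Vertex → Set₁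
  S y v = R y v × (∀ x → CoveredInJ y x → ¬ R x v)

  Core : Carrier → Vertex → Set₁
  Core y v = R y v × ¬ (Σ Carrier λ s → IsSup (CoveredInJ y) s × R s v)

  -- private part P(y): the connected component of G[S y] containing Core y
  -- (vertices of S y reachable inside G[S y] from some vertex of Core y)
  P : Carrier → Vertex → Set₁
  P y v = Σ Vertex λ w → Core y w × Reach (λ u → S y u) w v

-- A vertex v in P(y) ∩ P(z) lies in R(y) ∩ R(z) = R(y ∧ z). Every join-irreducible
-- below y ∧ z is below the meet i of y and z in J(L), and every element of a finite
-- lattice is the join of the join-irreducibles below it, so y ∧ z ≤ i and v ∈ R(i).
-- As y ≠ z, i is strictly below one of them, say y; then i lies below some x covered
-- by y in J(L), so v ∈ R(x), contradicting v ∈ P(y) ⊆ R(y) ∖ R(x).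
module Submission where

open import Defs
open import Level using (0ℓ)
open import Axiom.DoubleNegationElimination using (DoubleNegationElimination)
open import Data.Empty using (⊥; ⊥-elim)
open import Data.Fin using (_≟_)
open import Data.Fin.Induction using (po-wellFounded; po-noetherian)
open import Data.Product using (Σ; _×_; _,_; proj₁; proj₂)
open import Data.Sum using (_⊎_; inj₁; inj₂)
open import Function using (flip)
open import Induction.WellFounded using (Acc; acc)
open import Relation.Binary.Lattice.Structures using (IsLattice)
open import Relation.Binary.PropositionalEquality using (_≡_; refl; sym; trans; cong; subst; module ≡-Reasoning)
open import Relation.Nullary using (¬_; Dec; yes; no)

module LatticeFacts (L : FinLattice) where
  open FinLattice L
  open IsLattice isLattice public
    using (antisym; reflexive; x∧y≤x; x∧y≤y; ∧-greatest; isPartialOrder)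
    renaming (refl to ≤-refl; trans to ≤-trans)

  _≤?_ : ∀ a b → Dec (a ≤ b)
  a ≤? b with (a ∧ b) ≟ a
  ... | yes a∧b≡a = yes (subst (_≤ b) a∧b≡a (x∧y≤y a b))
  ... | no  a∧b≢a = no λ a≤b → a∧b≢a (antisym (x∧y≤x a b) (∧-greatest ≤-refl a≤b))

  ∧-idem : ∀ a → a ∧ a ≡ a
  ∧-idem a = antisym (x∧y≤x a a) (∧-greatest ≤-refl ≤-refl)

  ≤⇒∧≡ʳ : ∀ {a b} → a ≤ b → b ∧ a ≡ a
  ≤⇒∧≡ʳ a≤b = antisym (x∧y≤y _ _) (∧-greatest a≤b ≤-refl)

  -- JoinIrr quantifies over all predicates on L; feeding it the predicate
  -- "x < y, or x = y and Q" makes any join-irreducible a witness of classical logic.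
  joinIrr⇒dne : ∀ {y} → JoinIrr y → DoubleNegationElimination 0ℓ
  joinIrr⇒dne {y} y-irr {Q} ¬¬q with y-irr I (I≤y , y-least)
    where
    I : Carrier → Set
    I x = x < y ⊎ (x ≡ y × Q)

    I≤y : ∀ x → I x → x ≤ y
    I≤y x (inj₁ x<y)      = proj₁ x<y
    I≤y x (inj₂ (x≡y , _)) = reflexive x≡y

    y-least : ∀ u → (∀ x → I x → x ≤ u) → y ≤ u
    y-least u I≤u with y ≤? u
    ... | yes y≤u = y≤u
    ... | no  y≰u = ⊥-elim (¬¬q λ q → y≰u (I≤u y (inj₂ (refl , q))))
  ... | inj₁ (_ , y≢y) = ⊥-elim (y≢y refl)
  ... | inj₂ (_ , q)   = q

  -- If a ≰ i, every element strictly below a is ≤ i by induction, so a is the join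
  -- of no subset avoiding a: a is join-irreducible, hence ≤ i after all.
  joinIrr-lowerBounds⇒≤ : DoubleNegationElimination 0ℓ → ∀ i a →
                          (∀ u → JoinIrr u → u ≤ a → u ≤ i) → a ≤ i
  joinIrr-lowerBounds⇒≤ dne i a = go a (po-wellFounded isPartialOrder a)
    where
    go : ∀ a → Acc _<_ a → (∀ u → JoinIrr u → u ≤ a → u ≤ i) → a ≤ i
    go a (acc below) H = dne λ a≰i → a≰i (H a (a-irr a≰i) ≤-refl)
      where
      a-irr : ¬ a ≤ i → JoinIrr a
      a-irr a≰i I (I≤a , a-least) = dne λ a∉I → a≰i (a-least i (I≤i a∉I))
        where
        I≤i : ¬ I a → ∀ x → I x → x ≤ i
        I≤i a∉I x x∈I with x ≟ a
        ... | yes refl = ⊥-elim (a∉I x∈I)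
        ... | no  x≢a  = go x (below (I≤a x x∈I , x≢a))
                           λ u u-irr u≤x → H u u-irr (≤-trans u≤x (I≤a x x∈I))

  -- Climb from w towards y through J(L); finiteness makes the climb stop at a cover.
  below-coveredInJ : ∀ {y w} → JoinIrr w → w < y →
                     ¬ (∀ x → CoveredInJ y x → ¬ w ≤ x)
  below-coveredInJ {y} {w} w-irr w<y = go w w-irr w<y (po-noetherian isPartialOrder w)
    where
    go : ∀ w → JoinIrr w → w < y → Acc (flip _<_) w →
         ¬ (∀ x → CoveredInJ y x → ¬ w ≤ x)
    go w w-irr w<y (acc above) none = none w (w-irr , w<y , w-maximal) ≤-refl
      where
      w-maximal : ∀ w′ → JoinIrr w′ → w < w′ → w′ < y → ⊥
      w-maximal w′ w′-irr w<w′ w′<y = go w′ w′-irr w′<y (above w<w′)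
        λ x x-cov w′≤x → none x x-cov (≤-trans (proj₁ w<w′) w′≤x)

module RetractFacts {L : FinLattice} {G : Graph} (iso : EndIso L G) where
  open FinLattice L
  open Graph G using (Vertex; Reach; here; step)
  open EndIso iso
  open LatticeFacts L

  f : Carrier → Vertex → Vertex
  f a = proj₁ (φ a)

  R-fixed : ∀ {a v} → R a v → f a v ≡ v
  R-fixed {a} {v} (u , fu≡v) = begin
    f a v        ≡⟨ cong (f a) (sym fu≡v) ⟩
    f a (f a u)  ≡⟨ sym (φ-hom a a u) ⟩
    f (a ∧ a) u  ≡⟨ cong (λ c → f c u) (∧-idem a) ⟩
    f a u        ≡⟨ fu≡v ⟩
    v            ∎
    where open ≡-Reasoning

  R-mono : ∀ {a b v} → a ≤ b → R a v → R b v
  R-mono {a} {b} a≤b (u , fu≡v) =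
    f a u , trans (sym (φ-hom b a u)) (trans (cong (λ c → f c u) (≤⇒∧≡ʳ a≤b)) fu≡v)

  R-∧ : ∀ {a b v} → R a v → R b v → R (a ∧ b) v
  R-∧ {a} {b} {v} v∈Ra v∈Rb =
    v , trans (φ-hom a b v) (trans (cong (f a) (R-fixed v∈Rb)) (R-fixed v∈Ra))

  P⊆S : ∀ {y v} → P y v → S y v
  P⊆S (_ , _ , path) = target path
    where
    target : ∀ {T : Vertex → Set₁} {w u} → Reach T w u → T u
    target (here t)     = t
    target (step _ _ t) = t

  S-avoids-lower-joinIrr : ∀ {y i v} → S y v → JoinIrr i → i < y → ¬ R i v
  S-avoids-lower-joinIrr (_ , v∉covered) i-irr i<y v∈Ri =
    below-coveredInJ i-irr i<y λ x x-cov i≤x → v∉covered x x-cov (R-mono i≤x v∈Ri)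

lemma27 : (L : FinLattice) (G : Graph) (iso : EndIso L G) →
    FinLattice.JIsLattice L →
    (y z : FinLattice.Carrier L) →
    FinLattice.JoinIrr L y → FinLattice.JoinIrr L z → ¬ (y ≡ z) →
    (v : Graph.Vertex G) → EndIso.P iso y v → EndIso.P iso z v → ⊥
lemma27 L G iso J-lattice y z y-irr z-irr y≢z v v∈Py v∈Pz =
  excluded-by-meet-in-J (proj₂ (J-lattice y z y-irr z-irr))
  where
  open FinLattice L
  open LatticeFacts L
  open EndIso iso using (R; S)
  open RetractFacts iso

  v∈Sy : S y v
  v∈Sy = P⊆S v∈Py

  v∈Sz : S z v
  v∈Sz = P⊆S v∈Pz

  excluded-by-meet-in-J : (Σ Carrier λ i → JoinIrr i × i ≤ y × i ≤ z ×
                             (∀ u → JoinIrr u → u ≤ y → u ≤ z → u ≤ i)) → ⊥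
  excluded-by-meet-in-J (i , i-irr , i≤y , i≤z , i-greatest) = by-cases ((i ≟ y) , (i ≟ z))
    where
    y∧z≤i : (y ∧ z) ≤ i
    y∧z≤i = joinIrr-lowerBounds⇒≤ (joinIrr⇒dne y-irr) i (y ∧ z) λ u u-irr u≤y∧z →
      i-greatest u u-irr (≤-trans u≤y∧z (x∧y≤x y z)) (≤-trans u≤y∧z (x∧y≤y y z))

    v∈Ri : R i v
    v∈Ri = R-mono y∧z≤i (R-∧ (proj₁ v∈Sy) (proj₁ v∈Sz))

    by-cases : Dec (i ≡ y) × Dec (i ≡ z) → ⊥
    by-cases (yes i≡y , yes i≡z) = y≢z (trans (sym i≡y) i≡z)
    by-cases (no  i≢y , _)       = S-avoids-lower-joinIrr v∈Sy i-irr (i≤y , i≢y) v∈Ri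
    by-cases (_       , no  i≢z) = S-avoids-lower-joinIrr v∈Sz i-irr (i≤z , i≢z) v∈Ri
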